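{- Let $A\in\mathbb{Z}[[x]]^{n\times n}$ be invertible over $\mathbb{Z}[[x]]$ and let $C\in\mathbb{Z}[[x]]^{n\times n}$ with $C\approx_m A^{ -1}$. Suppose $A+\Delta A$ is invertible over $\mathbb{Z}[[x]]$ and $\Delta A=UBV$ with $U\in\mathbb{Z}[[x]]^{n\times k}$, $B\in\mathbb{Z}[[x]]^{k\times k}$ and $V\in\mathbb{Z}[[x]]^{k\times n}$. Then $$(A+\Delta A)^{ -1}\approx_m C-CU(I+BVCU)^{ -1}BVC.$$
   Context: For power series $\sum_i c_ix^i,\sum_i d_ix^i\in\mathbb{Z}[[x]]$, $g\approx_m h$ means $c_i=d_i$ for all $i\le m$; for matrices, $\approx_m$ is entrywise. A matrix over $\mathbb{Z}[[x]]$ is invertible over $\mathbb{Z}[[x]]$ if it has a right inverse with entries in $\mathbb{Z}[[x]]$. The inverse $(I+BVCU)^{ -1}$ is taken over $\mathbb{Z}[[x]]$ (or its field of fractions $\mathbb{Z}((x))$). -}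

module Defs where

open import Data.Nat using (ℕ; zero; suc; _∸_; _≤_)
open import Data.Integer using (ℤ; 0ℤ; 1ℤ) renaming (_+_ to _+ℤ_; _*_ to _*ℤ_; -_ to -ℤ_)
open import Data.Fin using (Fin; zero; suc)
open import Relation.Binary.PropositionalEquality using (_≡_)

-- Formal power series in ℤ[[x]], represented by their coefficient sequences.
PS : Set
PS = ℕ → ℤ

0ₚ : PS
0ₚ _ = 0ℤ

1ₚ : PS
1ₚ zero    = 1ℤ
1ₚ (suc _) = 0ℤ

_+ₚ_ : PS → PS → PS
(f +ₚ g) i = f i +ℤ g i

-ₚ_ : PS → PS
(-ₚ f) i = -ℤ (f i)

sumTo : ℕ → (ℕ → ℤ) → ℤ
sumTo zero    h = h zero
sumTo (suc n) h = sumTo n h +ℤ h (suc n)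

_*ₚ_ : PS → PS → PS
(f *ₚ g) n = sumTo n (λ i → f i *ℤ g (n ∸ i))

Mat : ℕ → ℕ → Set
Mat r c = Fin r → Fin c → PS

sumFin : ∀ {k} → (Fin k → PS) → PS
sumFin {zero}  h = 0ₚ
sumFin {suc k} h = h zero +ₚ sumFin (λ l → h (suc l))

_·_ : ∀ {r k c} → Mat r k → Mat k c → Mat r c
(M · N) i j = sumFin (λ l → M i l *ₚ N l j)

_⊕_ : ∀ {r c} → Mat r c → Mat r c → Mat r c
(M ⊕ N) i j = M i j +ₚ N i j

_⊖_ : ∀ {r c} → Mat r c → Mat r c → Mat r c
(M ⊖ N) i j = M i j +ₚ (-ₚ N i j)

idMat : ∀ {n} → Mat n n
idMat zero    zero    = 1ₚ
idMat zero    (suc _) = 0ₚ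
idMat (suc _) zero    = 0ₚ
idMat (suc i) (suc j) = idMat i j

_≋_ : ∀ {r c} → Mat r c → Mat r c → Set
M ≋ N = ∀ i j t → M i j t ≡ N i j t

_≈[_]_ : ∀ {r c} → Mat r c → ℕ → Mat r c → Set
M ≈[ m ] N = ∀ i j t → t ≤ m → M i j t ≡ N i j t

IsRightInverse : ∀ {n} → Mat n n → Mat n n → Set
IsRightInverse M R = (M · R) ≋ idMat

module Submission where

-- Write S for the given right inverse of A.  Exactly, the Sherman–Morrison–Woodbury
-- identity gives X = S − SU·(I + BVSU)⁻¹·BV·S, with (I + BVSU)⁻¹ = I − BVXU.  The
-- matrix I + BVCU agrees with I + BVSU up to order m, and the inverse of a matrix over
-- ℤ[[x]] depends only on its coefficients up to order m when computed to order m; so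
-- replacing S by C ≈ₘ S and the inverse by a right inverse W of I + BVCU preserves ≈ₘ.
--
-- The one non-formal ingredient is that a right inverse over the commutative ring ℤ[[x]]
-- is two-sided (Woodbury needs S·A = I and W₀·(I + BVSU) = I).  We prove it without
-- determinants: modulo (N, x) the ring is finite, where powers of a matrix repeat, which
-- forces one-sided inverses to be two-sided; hence R·M ≡ I mod x, and a matrix ≡ I mod x
-- is invertible by its Neumann series.

open import Defs
open import Data.Nat as ℕ using (ℕ; zero; suc; _∸_; _^_; z≤n; s≤s)
import Data.Nat.Properties as ℕP
open import Data.Nat.Divisibility using (>⇒∤)
open import Data.Integer as ℤ using (ℤ; +_; 0ℤ)
import Data.Integer.Properties as ℤP
open import Data.Integer.DivMod using (_%ℕ_; _/ℕ_; n%ℕd<d; a≡a%ℕn+[a/ℕn]*n)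
open import Data.Integer.Divisibility.Signed
  using (_∣_; divides; ∣⇒∣ᵤ; ∣m∣n⇒∣m+n; ∣m⇒∣-m; ∣n⇒∣m*n; ∣m⇒∣m*n)
open import Data.Integer.Tactic.RingSolver using (solve-∀)
open import Data.Fin as F using (Fin; zero; suc; toℕ; funToFin; finToFun)
import Data.Fin.Properties as FP
open import Data.Product using (Σ; _×_; _,_; proj₁; proj₂)
open import Relation.Nullary using (contradiction)
open import Relation.Binary.PropositionalEquality
open import Relation.Binary.Bundles using (Setoid)
import Relation.Binary.Reasoning.Setoid as SetoidReasoning

sumTo-cong : ∀ n {h h' : ℕ → ℤ} → (∀ i → i ℕ.≤ n → h i ≡ h' i) → sumTo n h ≡ sumTo n h'
sumTo-cong zero    h≡h' = h≡h' 0 z≤n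
sumTo-cong (suc n) h≡h' =
  cong₂ ℤ._+_ (sumTo-cong n (λ i i≤n → h≡h' i (ℕP.m≤n⇒m≤1+n i≤n))) (h≡h' (suc n) ℕP.≤-refl)

interchange : ∀ (a b c d : ℤ) → (a ℤ.+ b) ℤ.+ (c ℤ.+ d) ≡ (a ℤ.+ c) ℤ.+ (b ℤ.+ d)
interchange = solve-∀

sumTo-+ : ∀ n (h h' : ℕ → ℤ) → sumTo n (λ i → h i ℤ.+ h' i) ≡ sumTo n h ℤ.+ sumTo n h'
sumTo-+ zero    h h' = refl
sumTo-+ (suc n) h h' =
  trans (cong (ℤ._+ (h (suc n) ℤ.+ h' (suc n))) (sumTo-+ n h h'))
        (interchange (sumTo n h) (sumTo n h') (h (suc n)) (h' (suc n)))

sumTo-*ˡ : ∀ n c (h : ℕ → ℤ) → c ℤ.* sumTo n h ≡ sumTo n (λ i → c ℤ.* h i)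
sumTo-*ˡ zero    c h = refl
sumTo-*ˡ (suc n) c h =
  trans (ℤP.*-distribˡ-+ c (sumTo n h) (h (suc n))) (cong (ℤ._+ (c ℤ.* h (suc n))) (sumTo-*ˡ n c h))

sumTo-*ʳ : ∀ n c (h : ℕ → ℤ) → sumTo n h ℤ.* c ≡ sumTo n (λ i → h i ℤ.* c)
sumTo-*ʳ zero    c h = refl
sumTo-*ʳ (suc n) c h =
  trans (ℤP.*-distribʳ-+ c (sumTo n h) (h (suc n))) (cong (ℤ._+ (h (suc n) ℤ.* c)) (sumTo-*ʳ n c h))

sumTo-neg : ∀ n (h : ℕ → ℤ) → ℤ.- sumTo n h ≡ sumTo n (λ i → ℤ.- h i)
sumTo-neg zero    h = refl
sumTo-neg (suc n) h =
  trans (ℤP.neg-distrib-+ (sumTo n h) (h (suc n))) (cong (ℤ._+ (ℤ.- h (suc n))) (sumTo-neg n h))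

sumTo-zero : ∀ n (h : ℕ → ℤ) → (∀ i → i ℕ.≤ n → h i ≡ 0ℤ) → sumTo n h ≡ 0ℤ
sumTo-zero zero    h h≡0 = h≡0 0 z≤n
sumTo-zero (suc n) h h≡0 =
  cong₂ ℤ._+_ (sumTo-zero n h (λ i i≤n → h≡0 i (ℕP.m≤n⇒m≤1+n i≤n))) (h≡0 (suc n) ℕP.≤-refl)

sumTo-last : ∀ n (h : ℕ → ℤ) → (∀ i → i ℕ.< n → h i ≡ 0ℤ) → sumTo n h ≡ h n
sumTo-last zero    h _   = refl
sumTo-last (suc n) h h≡0 =
  trans (cong (ℤ._+ h (suc n)) (sumTo-zero n h (λ i i≤n → h≡0 i (ℕ.s≤s i≤n)))) (ℤP.+-identityˡ _)

sumTo-first : ∀ n (h : ℕ → ℤ) → (∀ i → h (suc i) ≡ 0ℤ) → sumTo n h ≡ h 0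
sumTo-first zero    h _   = refl
sumTo-first (suc n) h h≡0 = trans (cong₂ ℤ._+_ (sumTo-first n h h≡0) (h≡0 n)) (ℤP.+-identityʳ _)

-- Exchange of summation over the triangle 0 ≤ i ≤ s ≤ n, reindexing s = i + d.
-- This is the combinatorial heart of associativity of the Cauchy product.
sumTo-triangle : ∀ n (F : ℕ → ℕ → ℤ) →
  sumTo n (λ s → sumTo s (λ i → F i s)) ≡ sumTo n (λ i → sumTo (n ∸ i) (λ d → F i (i ℕ.+ d)))
sumTo-triangle zero    F = refl
sumTo-triangle (suc n) F = begin
    sumTo n (λ s → sumTo s (λ i → F i s)) ℤ.+ (column ℤ.+ F (suc n) (suc n))
  ≡⟨ cong (ℤ._+ (column ℤ.+ F (suc n) (suc n))) (sumTo-triangle n F) ⟩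
    rows ℤ.+ (column ℤ.+ F (suc n) (suc n))
  ≡⟨ sym (ℤP.+-assoc rows column (F (suc n) (suc n))) ⟩
    (rows ℤ.+ column) ℤ.+ F (suc n) (suc n)
  ≡⟨ cong₂ ℤ._+_ (sym (sumTo-+ n _ _)) lastRow ⟩
    sumTo n (λ i → row n i ℤ.+ F i (suc n)) ℤ.+ row (suc n) (suc n)
  ≡⟨ cong (ℤ._+ row (suc n) (suc n)) (sumTo-cong n extendRow) ⟩
    sumTo n (λ i → row (suc n) i) ℤ.+ row (suc n) (suc n)
  ∎
  where
  open ≡-Reasoning
  row : ℕ → ℕ → ℤ
  row n i = sumTo (n ∸ i) (λ d → F i (i ℕ.+ d))
  rows column : ℤ
  rows   = sumTo n (row n)
  column = sumTo n (λ i → F i (suc n))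
  lastRow : F (suc n) (suc n) ≡ row (suc n) (suc n)
  lastRow rewrite ℕP.n∸n≡0 n | ℕP.+-identityʳ n = refl
  extendRow : ∀ i → i ℕ.≤ n → row n i ℤ.+ F i (suc n) ≡ row (suc n) i
  extendRow i i≤n rewrite ℕP.+-∸-assoc 1 i≤n =
    cong (λ j → row n i ℤ.+ F i j) (sym (trans (ℕP.+-suc i (n ∸ i)) (cong suc (ℕP.m+[n∸m]≡n i≤n))))

*ₚ-assoc : ∀ f g h → ((f *ₚ g) *ₚ h) ≗ (f *ₚ (g *ₚ h))
*ₚ-assoc f g h n = begin
    sumTo n (λ s → sumTo s (λ i → f i ℤ.* g (s ∸ i)) ℤ.* h (n ∸ s))
  ≡⟨ sumTo-cong n (λ s _ → sumTo-*ʳ s (h (n ∸ s)) _) ⟩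
    sumTo n (λ s → sumTo s (λ i → f i ℤ.* g (s ∸ i) ℤ.* h (n ∸ s)))
  ≡⟨ sumTo-triangle n (λ i s → f i ℤ.* g (s ∸ i) ℤ.* h (n ∸ s)) ⟩
    sumTo n (λ i → sumTo (n ∸ i) (λ d → f i ℤ.* g ((i ℕ.+ d) ∸ i) ℤ.* h (n ∸ (i ℕ.+ d))))
  ≡⟨ sumTo-cong n (λ i _ → sumTo-cong (n ∸ i) (λ d _ → reindex i d)) ⟩
    sumTo n (λ i → sumTo (n ∸ i) (λ d → f i ℤ.* (g d ℤ.* h ((n ∸ i) ∸ d))))
  ≡⟨ sumTo-cong n (λ i _ → sym (sumTo-*ˡ (n ∸ i) (f i) _)) ⟩
    sumTo n (λ i → f i ℤ.* sumTo (n ∸ i) (λ d → g d ℤ.* h ((n ∸ i) ∸ d)))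
  ∎
  where
  open ≡-Reasoning
  reindex : ∀ i d → f i ℤ.* g ((i ℕ.+ d) ∸ i) ℤ.* h (n ∸ (i ℕ.+ d)) ≡ f i ℤ.* (g d ℤ.* h ((n ∸ i) ∸ d))
  reindex i d rewrite ℕP.m+n∸m≡n i d | sym (ℕP.∸-+-assoc n i d) = ℤP.*-assoc (f i) (g d) _

*ₚ-distribˡ : ∀ f g h → (f *ₚ (g +ₚ h)) ≗ ((f *ₚ g) +ₚ (f *ₚ h))
*ₚ-distribˡ f g h n =
  trans (sumTo-cong n (λ i _ → ℤP.*-distribˡ-+ (f i) (g (n ∸ i)) (h (n ∸ i))))
        (sumTo-+ n (λ i → f i ℤ.* g (n ∸ i)) (λ i → f i ℤ.* h (n ∸ i)))

*ₚ-distribʳ : ∀ f g h → ((g +ₚ h) *ₚ f) ≗ ((g *ₚ f) +ₚ (h *ₚ f))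
*ₚ-distribʳ f g h n =
  trans (sumTo-cong n (λ i _ → ℤP.*-distribʳ-+ (f (n ∸ i)) (g i) (h i)))
        (sumTo-+ n (λ i → g i ℤ.* f (n ∸ i)) (λ i → h i ℤ.* f (n ∸ i)))

*ₚ-identityˡ : ∀ f → (1ₚ *ₚ f) ≗ f
*ₚ-identityˡ f n = trans (sumTo-first n _ (λ _ → refl)) (ℤP.*-identityˡ (f n))

*ₚ-identityʳ : ∀ f → (f *ₚ 1ₚ) ≗ f
*ₚ-identityʳ f n =
  trans (sumTo-last n _ (λ i i<n → trans (cong (f i ℤ.*_) (1ₚ-pos (ℕP.m>n⇒m∸n≢0 i<n))) (ℤP.*-zeroʳ (f i))))
        (trans (cong (λ k → f n ℤ.* 1ₚ k) (ℕP.n∸n≡0 n)) (ℤP.*-identityʳ (f n)))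
  where
  1ₚ-pos : ∀ {k} → k ≢ 0 → 1ₚ k ≡ 0ℤ
  1ₚ-pos {zero}  k≢0 = contradiction refl k≢0
  1ₚ-pos {suc k} _   = refl

*ₚ-negʳ : ∀ f g → (f *ₚ (-ₚ g)) ≗ (-ₚ (f *ₚ g))
*ₚ-negʳ f g n = trans (sumTo-cong n (λ i _ → sym (ℤP.neg-distribʳ-* (f i) _))) (sym (sumTo-neg n _))

*ₚ-zeroˡ : ∀ f → (0ₚ *ₚ f) ≗ 0ₚ
*ₚ-zeroˡ f n = sumTo-zero n _ (λ _ _ → refl)

*ₚ-zeroʳ : ∀ f → (f *ₚ 0ₚ) ≗ 0ₚ
*ₚ-zeroʳ f n = sumTo-zero n _ (λ i _ → ℤP.*-zeroʳ (f i))

-- We use three of them: equality, agreement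
-- up to order m, and agreement of constant terms modulo N.
record Congruence : Set₁ where
  field
    _≈_      : PS → PS → Set
    ≈-sym    : ∀ {f g} → f ≈ g → g ≈ f
    ≈-trans  : ∀ {f g h} → f ≈ g → g ≈ h → f ≈ h
    ≗⇒≈      : ∀ {f g} → f ≗ g → f ≈ g
    +-cong   : ∀ {f f' g g'} → f ≈ f' → g ≈ g' → (f +ₚ g) ≈ (f' +ₚ g')
    *-cong   : ∀ {f f' g g'} → f ≈ f' → g ≈ g' → (f *ₚ g) ≈ (f' *ₚ g')
    neg-cong : ∀ {f f'} → f ≈ f' → (-ₚ f) ≈ (-ₚ f')

exact : Congruence
exact = record
  { _≈_      = _≗_
  ; ≈-sym    = λ p t → sym (p t)
  ; ≈-trans  = λ p q t → trans (p t) (q t)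
  ; ≗⇒≈      = λ p → p
  ; +-cong   = λ p q t → cong₂ ℤ._+_ (p t) (q t)
  ; *-cong   = λ p q t → sumTo-cong t (λ i _ → cong₂ ℤ._*_ (p i) (q (t ∸ i)))
  ; neg-cong = λ p t → cong ℤ.-_ (p t)
  }

truncation : ℕ → Congruence
truncation m = record
  { _≈_      = λ f g → ∀ t → t ℕ.≤ m → f t ≡ g t
  ; ≈-sym    = λ p t t≤m → sym (p t t≤m)
  ; ≈-trans  = λ p q t t≤m → trans (p t t≤m) (q t t≤m)
  ; ≗⇒≈      = λ p t _ → p t
  ; +-cong   = λ p q t t≤m → cong₂ ℤ._+_ (p t t≤m) (q t t≤m)
  ; *-cong   = λ p q t t≤m → sumTo-cong t (λ i i≤t →
                 cong₂ ℤ._*_ (p i (ℕP.≤-trans i≤t t≤m)) (q (t ∸ i) (ℕP.≤-trans (ℕP.m∸n≤m t i) t≤m)))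
  ; neg-cong = λ p t t≤m → cong ℤ.-_ (p t t≤m)
  }

-- f ≈ g iff N divides f(0) − g(0): the kernel of ℤ[[x]] → ℤ/Nℤ.  Its residue
-- classes are classified by the remainder of the constant term, so there are only N.
module ConstantTermMod (N : ℕ) .{{_ : ℕ.NonZero N}} where

  _≡ₙ_ : PS → PS → Set
  f ≡ₙ g = + N ∣ f 0 ℤ.- g 0

  private
    neg-sub : ∀ (a b : ℤ) → ℤ.- (a ℤ.- b) ≡ b ℤ.- a
    neg-sub = solve-∀
    sub-trans : ∀ (a b c : ℤ) → (a ℤ.- b) ℤ.+ (b ℤ.- c) ≡ a ℤ.- c
    sub-trans = solve-∀
    sub-+ : ∀ (a b c d : ℤ) → (a ℤ.- c) ℤ.+ (b ℤ.- d) ≡ (a ℤ.+ b) ℤ.- (c ℤ.+ d)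
    sub-+ = solve-∀
    sub-* : ∀ (a b c d : ℤ) → a ℤ.* (b ℤ.- d) ℤ.+ (a ℤ.- c) ℤ.* d ≡ a ℤ.* b ℤ.- c ℤ.* d
    sub-* = solve-∀
    sub-neg : ∀ (a b : ℤ) → ℤ.- (a ℤ.- b) ≡ (ℤ.- a) ℤ.- (ℤ.- b)
    sub-neg = solve-∀
    sub-residues : ∀ (r x y n : ℤ) → (r ℤ.+ x ℤ.* n) ℤ.- (r ℤ.+ y ℤ.* n) ≡ (x ℤ.- y) ℤ.* n
    sub-residues = solve-∀

  congruence : Congruence
  congruence = record
    { _≈_      = _≡ₙ_
    ; ≈-sym    = λ {f g} p → subst (+ N ∣_) (neg-sub (f 0) (g 0)) (∣m⇒∣-m p)
    ; ≈-trans  = λ {f g h} p q → subst (+ N ∣_) (sub-trans (f 0) (g 0) (h 0)) (∣m∣n⇒∣m+n p q)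
    ; ≗⇒≈      = λ {f g} f≗g →
        divides 0ℤ (trans (cong (λ x → f 0 ℤ.- x) (sym (f≗g 0))) (trans (ℤP.+-inverseʳ (f 0)) (sym (ℤP.*-zeroˡ (+ N)))))
    ; +-cong   = λ {f f' g g'} p q → subst (+ N ∣_) (sub-+ (f 0) (g 0) (f' 0) (g' 0)) (∣m∣n⇒∣m+n p q)
    ; *-cong   = λ {f f' g g'} p q →
        subst (+ N ∣_) (sub-* (f 0) (g 0) (f' 0) (g' 0)) (∣m∣n⇒∣m+n (∣n⇒∣m*n (f 0) q) (∣m⇒∣m*n (g' 0) p))
    ; neg-cong = λ {f f'} p → subst (+ N ∣_) (sub-neg (f 0) (f' 0)) (∣m⇒∣-m p)
    }

  residue : PS → Fin N
  residue f = F.fromℕ< (n%ℕd<d (f 0) N)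

  residue-sound : ∀ {f g} → residue f ≡ residue g → f ≡ₙ g
  residue-sound {f} {g} same = divides (f 0 /ℕ N ℤ.- g 0 /ℕ N) (begin
      f 0 ℤ.- g 0
    ≡⟨ cong₂ ℤ._-_ (a≡a%ℕn+[a/ℕn]*n (f 0) N) (a≡a%ℕn+[a/ℕn]*n (g 0) N) ⟩
      (+ (f 0 %ℕ N) ℤ.+ (f 0 /ℕ N) ℤ.* + N) ℤ.- (+ (g 0 %ℕ N) ℤ.+ (g 0 /ℕ N) ℤ.* + N)
    ≡⟨ cong (λ r → (+ r ℤ.+ (f 0 /ℕ N) ℤ.* + N) ℤ.- (+ (g 0 %ℕ N) ℤ.+ (g 0 /ℕ N) ℤ.* + N)) same-remainder ⟩
      (+ (g 0 %ℕ N) ℤ.+ (f 0 /ℕ N) ℤ.* + N) ℤ.- (+ (g 0 %ℕ N) ℤ.+ (g 0 /ℕ N) ℤ.* + N)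
    ≡⟨ sub-residues (+ (g 0 %ℕ N)) (f 0 /ℕ N) (g 0 /ℕ N) (+ N) ⟩
      (f 0 /ℕ N ℤ.- g 0 /ℕ N) ℤ.* + N
    ∎)
    where
    open ≡-Reasoning
    same-remainder : f 0 %ℕ N ≡ g 0 %ℕ N
    same-remainder = trans (sym (FP.toℕ-fromℕ< _)) (trans (cong toℕ same) (FP.toℕ-fromℕ< _))

-- Instantiated with `exact` this is plain
-- matrix algebra; instantiated with `truncation m` it is matrix algebra modulo x^(m+1).
module MatrixAlgebra (R : Congruence) where
  open Congruence R public

  ≈-refl : ∀ {f} → f ≈ f
  ≈-refl = ≗⇒≈ (λ _ → refl)

  sumFin-cong : ∀ {k} {h h' : Fin k → PS} → (∀ l → h l ≈ h' l) → sumFin h ≈ sumFin h'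
  sumFin-cong {zero}  _     = ≈-refl
  sumFin-cong {suc k} h≈h' = +-cong (h≈h' zero) (sumFin-cong (λ l → h≈h' (suc l)))

  sumFin-0 : ∀ {k} → sumFin {k} (λ _ → 0ₚ) ≈ 0ₚ
  sumFin-0 {zero}  = ≈-refl
  sumFin-0 {suc k} = ≈-trans (+-cong (≈-refl {0ₚ}) (sumFin-0 {k})) (≗⇒≈ (λ t → ℤP.+-identityʳ 0ℤ))

  sumFin-+ : ∀ {k} (h h' : Fin k → PS) → sumFin (λ l → h l +ₚ h' l) ≈ (sumFin h +ₚ sumFin h')
  sumFin-+ {zero}  h h' = ≗⇒≈ (λ t → refl)
  sumFin-+ {suc k} h h' = ≈-trans (+-cong (≈-refl {h zero +ₚ h' zero}) (sumFin-+ (λ l → h (suc l)) (λ l → h' (suc l))))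
    (≗⇒≈ (λ t → interchange (h zero t) (h' zero t) (sumFin (λ l → h (suc l)) t) (sumFin (λ l → h' (suc l)) t)))

  sumFin-*ˡ : ∀ {k} f (h : Fin k → PS) → (f *ₚ sumFin h) ≈ sumFin (λ l → f *ₚ h l)
  sumFin-*ˡ {zero}  f h = ≗⇒≈ (*ₚ-zeroʳ f)
  sumFin-*ˡ {suc k} f h =
    ≈-trans (≗⇒≈ (*ₚ-distribˡ f (h zero) (sumFin (λ l → h (suc l))))) (+-cong (≈-refl {f *ₚ h zero}) (sumFin-*ˡ f (λ l → h (suc l))))

  sumFin-*ʳ : ∀ {k} f (h : Fin k → PS) → (sumFin h *ₚ f) ≈ sumFin (λ l → h l *ₚ f)
  sumFin-*ʳ {zero}  f h = ≗⇒≈ (*ₚ-zeroˡ f)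
  sumFin-*ʳ {suc k} f h =
    ≈-trans (≗⇒≈ (*ₚ-distribʳ f (h zero) (sumFin (λ l → h (suc l))))) (+-cong (≈-refl {h zero *ₚ f}) (sumFin-*ʳ f (λ l → h (suc l))))

  sumFin-neg : ∀ {k} (h : Fin k → PS) → sumFin (λ l → -ₚ h l) ≈ (-ₚ sumFin h)
  sumFin-neg {zero}  h = ≈-refl
  sumFin-neg {suc k} h = ≈-trans (+-cong (≈-refl { -ₚ h zero}) (sumFin-neg (λ l → h (suc l))))
    (≗⇒≈ (λ t → sym (ℤP.neg-distrib-+ (h zero t) (sumFin (λ l → h (suc l)) t))))

  sumFin-swap : ∀ {a b} (H : Fin a → Fin b → PS) →
    sumFin (λ x → sumFin (λ y → H x y)) ≈ sumFin (λ y → sumFin (λ x → H x y))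
  sumFin-swap {zero}  {b} H = ≈-sym (sumFin-0 {b})
  sumFin-swap {suc a} H = ≈-trans (+-cong (≈-refl {sumFin (H zero)}) (sumFin-swap (λ x → H (suc x))))
    (≈-sym (sumFin-+ (H zero) (λ y → sumFin (λ x → H (suc x) y))))

  sumFin-δˡ : ∀ {k} (i : Fin k) (h : Fin k → PS) → sumFin (λ l → idMat i l *ₚ h l) ≈ h i
  sumFin-δˡ {suc k} zero h = ≈-trans
    (+-cong (≗⇒≈ (*ₚ-identityˡ (h zero))) (≈-trans (sumFin-cong (λ l → ≗⇒≈ (*ₚ-zeroˡ (h (suc l))))) (sumFin-0 {k})))
    (≗⇒≈ (λ t → ℤP.+-identityʳ (h zero t)))
  sumFin-δˡ (suc i) h = ≈-trans (+-cong (≗⇒≈ (*ₚ-zeroˡ (h zero))) (sumFin-δˡ i (λ l → h (suc l))))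
    (≗⇒≈ (λ t → ℤP.+-identityˡ _))

  sumFin-δʳ : ∀ {k} (j : Fin k) (h : Fin k → PS) → sumFin (λ l → h l *ₚ idMat l j) ≈ h j
  sumFin-δʳ {suc k} zero h = ≈-trans
    (+-cong (≗⇒≈ (*ₚ-identityʳ (h zero))) (≈-trans (sumFin-cong (λ l → ≗⇒≈ (*ₚ-zeroʳ (h (suc l))))) (sumFin-0 {k})))
    (≗⇒≈ (λ t → ℤP.+-identityʳ (h zero t)))
  sumFin-δʳ (suc j) h = ≈-trans (+-cong (≗⇒≈ (*ₚ-zeroʳ (h zero))) (sumFin-δʳ j (λ l → h (suc l))))
    (≗⇒≈ (λ t → ℤP.+-identityˡ _))

  -- Entrywise congruence of matrices.  It is wrapped in a record so that the two
  -- matrices can be inferred from the type of a proof.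
  infix 4 _≈M_
  record _≈M_ {r c} (M N : Mat r c) : Set where
    constructor entrywise
    field entry : ∀ i j → M i j ≈ N i j
  open _≈M_ public

  M-refl : ∀ {r c} {M : Mat r c} → M ≈M M
  M-refl = entrywise (λ i j → ≈-refl)

  M-sym : ∀ {r c} {M N : Mat r c} → M ≈M N → N ≈M M
  M-sym p = entrywise (λ i j → ≈-sym (entry p i j))

  M-trans : ∀ {r c} {M N P : Mat r c} → M ≈M N → N ≈M P → M ≈M P
  M-trans p q = entrywise (λ i j → ≈-trans (entry p i j) (entry q i j))

  exact⇒ : ∀ {r c} {M N : Mat r c} → M ≋ N → M ≈M N
  exact⇒ p = entrywise (λ i j → ≗⇒≈ (p i j))

  matSetoid : ℕ → ℕ → Setoid _ _
  matSetoid r c = record { Carrier = Mat r c ; _≈_ = _≈M_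
                         ; isEquivalence = record { refl = M-refl ; sym = M-sym ; trans = M-trans } }

  module MatReasoning {r c : ℕ} = SetoidReasoning (matSetoid r c)

  ·-cong : ∀ {r k c} {M M' : Mat r k} {N N' : Mat k c} → M ≈M M' → N ≈M N' → (M · N) ≈M (M' · N')
  ·-cong p q = entrywise (λ i j → sumFin-cong (λ l → *-cong (entry p i l) (entry q l j)))

  ·-congˡ : ∀ {r k c} {M M' : Mat r k} (N : Mat k c) → M ≈M M' → (M · N) ≈M (M' · N)
  ·-congˡ N p = ·-cong p (M-refl {M = N})

  ·-congʳ : ∀ {r k c} (M : Mat r k) {N N' : Mat k c} → N ≈M N' → (M · N) ≈M (M · N')
  ·-congʳ M q = ·-cong (M-refl {M = M}) q

  ⊕-cong : ∀ {r c} {M M' N N' : Mat r c} → M ≈M M' → N ≈M N' → (M ⊕ N) ≈M (M' ⊕ N')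
  ⊕-cong p q = entrywise (λ i j → +-cong (entry p i j) (entry q i j))

  ⊖-cong : ∀ {r c} {M M' N N' : Mat r c} → M ≈M M' → N ≈M N' → (M ⊖ N) ≈M (M' ⊖ N')
  ⊖-cong p q = entrywise (λ i j → +-cong (entry p i j) (neg-cong (entry q i j)))

  ·-assoc : ∀ {a b c d} (M : Mat a b) (N : Mat b c) (P : Mat c d) → ((M · N) · P) ≈M (M · (N · P))
  ·-assoc M N P = entrywise λ i j → ≈-trans (sumFin-cong (λ y → sumFin-*ʳ (P y j) (λ x → M i x *ₚ N x y)))
    (≈-trans (sumFin-swap (λ y x → (M i x *ₚ N x y) *ₚ P y j))
      (sumFin-cong (λ x → ≈-trans (sumFin-cong (λ y → ≗⇒≈ (*ₚ-assoc (M i x) (N x y) (P y j))))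
                                  (≈-sym (sumFin-*ˡ (M i x) (λ y → N x y *ₚ P y j))))))

  ·-identityˡ : ∀ {r c} (M : Mat r c) → (idMat · M) ≈M M
  ·-identityˡ M = entrywise λ i j → sumFin-δˡ i (λ l → M l j)

  ·-identityʳ : ∀ {r c} (M : Mat r c) → (M · idMat) ≈M M
  ·-identityʳ M = entrywise λ i j → sumFin-δʳ j (λ l → M i l)

  ·-distribˡ : ∀ {a b c} (M : Mat a b) (N P : Mat b c) → (M · (N ⊕ P)) ≈M ((M · N) ⊕ (M · P))
  ·-distribˡ M N P = entrywise λ i j → ≈-trans (sumFin-cong (λ l → ≗⇒≈ (*ₚ-distribˡ (M i l) (N l j) (P l j))))
    (sumFin-+ (λ l → M i l *ₚ N l j) (λ l → M i l *ₚ P l j))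

  ·-distribʳ : ∀ {a b c} (M : Mat b c) (N P : Mat a b) → ((N ⊕ P) · M) ≈M ((N · M) ⊕ (P · M))
  ·-distribʳ M N P = entrywise λ i j → ≈-trans (sumFin-cong (λ l → ≗⇒≈ (*ₚ-distribʳ (M l j) (N i l) (P i l))))
    (sumFin-+ (λ l → N i l *ₚ M l j) (λ l → P i l *ₚ M l j))

  ·-⊖ˡ : ∀ {a b c} (M : Mat a b) (N P : Mat b c) → (M · (N ⊖ P)) ≈M ((M · N) ⊖ (M · P))
  ·-⊖ˡ M N P = entrywise λ i j → ≈-trans (entry (·-distribˡ M N (λ l j → -ₚ P l j)) i j)
    (+-cong (≈-refl {(M · N) i j}) (≈-trans (sumFin-cong (λ l → ≗⇒≈ (*ₚ-negʳ (M i l) (P l j)))) (sumFin-neg (λ l → M i l *ₚ P l j))))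

  ⊕⊖-cancel : ∀ {r c} (M N : Mat r c) → ((M ⊕ N) ⊖ N) ≈M M
  ⊕⊖-cancel M N = entrywise λ i j → ≗⇒≈ (λ t → add-sub (M i j t) (N i j t))
    where
    add-sub : ∀ (a b : ℤ) → (a ℤ.+ b) ℤ.- b ≡ a
    add-sub = solve-∀

  left-inverse-is-two-sided : ∀ {n} (L R Q : Mat n n) →
    (L · R) ≈M idMat → (R · Q) ≈M idMat → (R · L) ≈M idMat
  left-inverse-is-two-sided L R Q LR RQ = begin
      R · L                ≈⟨ ·-congʳ R L≈Q ⟩
      R · Q                ≈⟨ RQ ⟩
      idMat                ∎
    where
    open MatReasoning
    L≈Q : L ≈M Q
    L≈Q = begin
      L                    ≈⟨ M-sym (·-identityʳ L) ⟩
      L · idMat            ≈⟨ ·-congʳ L (M-sym RQ) ⟩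
      L · (R · Q)          ≈⟨ M-sym (·-assoc L R Q) ⟩
      (L · R) · Q          ≈⟨ ·-congˡ Q LR ⟩
      idMat · Q            ≈⟨ ·-identityˡ Q ⟩
      Q                    ∎

funToFin-injective : ∀ {m n} {f g : Fin m → Fin n} → funToFin f ≡ funToFin g → ∀ i → f i ≡ g i
funToFin-injective {f = f} {g} same i =
  trans (sym (FP.finToFun-funToFin f i)) (trans (cong (λ c → finToFun c i) same) (FP.finToFun-funToFin g i))

-- Over a quotient of ℤ[[x]] with finitely many classes, a one-sided inverse of a square
-- matrix is two-sided.  The powers B⁰, B¹, … fall into finitely many classes, so
-- Bᵃ ≈ Bᵃ⁺¹⁺ᶜ for some a, c; cancelling Bᵃ with Aᵃ (AB = I) gives B·Bᶜ ≈ I.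
module FiniteQuotient (R : Congruence) {K : ℕ} (class : PS → Fin K)
       (class-sound : ∀ {f g} → class f ≡ class g → Congruence._≈_ R f g) where
  open MatrixAlgebra R

  code : ∀ {n} → Mat n n → Fin ((K ^ n) ^ n)
  code M = funToFin (λ i → funToFin (λ j → class (M i j)))

  code-sound : ∀ {n} {M N : Mat n n} → code M ≡ code N → M ≈M N
  code-sound same = entrywise λ i j → class-sound (funToFin-injective (funToFin-injective same i) j)

  pow : ∀ {n} → Mat n n → ℕ → Mat n n
  pow M zero    = idMat
  pow M (suc a) = M · pow M a

  pow-+ : ∀ {n} (M : Mat n n) a c → pow M (a ℕ.+ c) ≈M (pow M a · pow M c)
  pow-+ M zero    c = M-sym (·-identityˡ (pow M c))
  pow-+ M (suc a) c = M-trans (·-congʳ M (pow-+ M a c)) (M-sym (·-assoc M (pow M a) (pow M c)))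

  pow-sucʳ : ∀ {n} (M : Mat n n) a → pow M (suc a) ≈M (pow M a · M)
  pow-sucʳ M zero    = M-trans (·-identityʳ M) (M-sym (·-identityˡ M))
  pow-sucʳ M (suc a) = M-trans (·-congʳ M (pow-sucʳ M a)) (M-sym (·-assoc M (pow M a) M))

  pow-inverse : ∀ {n} {A B : Mat n n} → (A · B) ≈M idMat → ∀ a → (pow A a · pow B a) ≈M idMat
  pow-inverse AB zero = ·-identityˡ idMat
  pow-inverse {A = A} {B} AB (suc a) = begin
      pow A (suc a) · (B · pow B a)      ≈⟨ ·-congˡ (B · pow B a) (pow-sucʳ A a) ⟩
      (pow A a · A) · (B · pow B a)      ≈⟨ ·-assoc (pow A a) A (B · pow B a) ⟩
      pow A a · (A · (B · pow B a))      ≈⟨ ·-congʳ (pow A a) (M-sym (·-assoc A B (pow B a))) ⟩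
      pow A a · ((A · B) · pow B a)      ≈⟨ ·-congʳ (pow A a) (M-trans (·-congˡ (pow B a) AB) (·-identityˡ (pow B a))) ⟩
      pow A a · pow B a                  ≈⟨ pow-inverse AB a ⟩
      idMat                              ∎
    where open MatReasoning

  -- Pigeonhole on the codes of B⁰, …, Bᴷ' (K' = number of codes) yields Bᵃ ≈ Bᵃ⁺¹⁺ᶜ.
  right⇒left : ∀ {n} (A B : Mat n n) → (A · B) ≈M idMat → (B · A) ≈M idMat
  right⇒left A B AB with FP.pigeonhole (ℕP.n<1+n _) (λ i → code (pow B (toℕ i)))
  ... | i , j , i<j , same = left-inverse-is-two-sided A B (pow B c) AB B·Bᶜ
    where
    open MatReasoning
    a c : ℕ
    a = toℕ i
    c = toℕ j ∸ suc a
    Bᵃ≈ : pow B a ≈M pow B (a ℕ.+ suc c)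
    Bᵃ≈ = subst (λ e → pow B a ≈M pow B e)
                (trans (sym (ℕP.m+[n∸m]≡n i<j)) (sym (ℕP.+-suc a c))) (code-sound same)
    B·Bᶜ : (B · pow B c) ≈M idMat
    B·Bᶜ = begin
      pow B (suc c)                      ≈⟨ M-sym (·-identityˡ (pow B (suc c))) ⟩
      idMat · pow B (suc c)              ≈⟨ ·-congˡ (pow B (suc c)) (M-sym (pow-inverse AB a)) ⟩
      (pow A a · pow B a) · pow B (suc c) ≈⟨ ·-assoc (pow A a) (pow B a) (pow B (suc c)) ⟩
      pow A a · (pow B a · pow B (suc c)) ≈⟨ ·-congʳ (pow A a) (M-sym (M-trans Bᵃ≈ (pow-+ B a (suc c)))) ⟩
      pow A a · pow B a                  ≈⟨ pow-inverse AB a ⟩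
      idMat                              ∎

divisible-by-all⇒zero : (d : ℤ) → (∀ N → + suc N ∣ d) → d ≡ 0ℤ
divisible-by-all⇒zero d all = ℤP.∣i∣≡0⇒i≡0 ∣d∣≡0
  where
  ∣d∣≡0 : ℤ.∣ d ∣ ≡ 0
  ∣d∣≡0 with ℤ.∣ d ∣ | ∣⇒∣ᵤ (all ℤ.∣ d ∣)
  ... | zero  | _       = refl
  ... | suc k | 2+k∣1+k = contradiction 2+k∣1+k (>⇒∤ (ℕP.n<1+n (suc k)))

*ₚ-raises-agreement : ∀ s (e p q : PS) → e 0 ≡ 0ℤ →
  (∀ t → t ℕ.< s → p t ≡ q t) → ∀ t → t ℕ.≤ s → (e *ₚ p) t ≡ (e *ₚ q) t
*ₚ-raises-agreement s e p q e₀≡0 p≈q t t≤s = sumTo-cong t term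
  where
  term : ∀ i → i ℕ.≤ t → e i ℤ.* p (t ∸ i) ≡ e i ℤ.* q (t ∸ i)
  term zero    _     = trans (cong (ℤ._* p t) e₀≡0) (sym (cong (ℤ._* q t) e₀≡0))
  term (suc i) i<t = cong (e (suc i) ℤ.*_)
    (p≈q (t ∸ suc i) (ℕP.<-≤-trans (ℕP.∸-monoʳ-< {o = 0} (s≤s z≤n) i<t) t≤s))

-- A matrix D ≡ I mod x has a right inverse over ℤ[[x]]: with E = I − D (no constant
-- terms), the iterates G₀ = 0, Gₛ₊₁ = I + E·Gₛ (partial Neumann sums Σ Eᵏ) stabilise
-- one degree at a time, and their diagonal limit G satisfies D·G = I.
module NeumannSeries {k} (D : Mat k k) (D≈I : D ≈[ 0 ] idMat) where

  E : Mat k k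
  E = idMat ⊖ D

  E₀≡0 : ∀ i j → E i j 0 ≡ 0ℤ
  E₀≡0 i j = trans (cong (λ x → idMat i j 0 ℤ.+ ℤ.- x) (D≈I i j 0 z≤n)) (ℤP.+-inverseʳ (idMat i j 0))

  ·-raises-agreement : ∀ s {P Q : Mat k k} →
    (∀ i j t → t ℕ.< s → P i j t ≡ Q i j t) → (E · P) ≈[ s ] (E · Q)
  ·-raises-agreement s {P} {Q} P≈Q i j = sumFin-cong (λ l →
      *ₚ-raises-agreement s (E i l) (P l j) (Q l j) (E₀≡0 i l) (P≈Q l j))
    where open MatrixAlgebra (truncation s)

  iterate : ℕ → Mat k k
  iterate zero    _ _ = 0ₚ
  iterate (suc s)     = idMat ⊕ (E · iterate s)

  -- Consecutive iterates agree up to degree s; for the step we only need them to agree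
  -- below degree s, which is the previous case.
  iterate-step : ∀ s → iterate (suc s) ≈[ s ] iterate (suc (suc s))
  iterate-agree-below : ∀ s i j t → t ℕ.< s → iterate s i j t ≡ iterate (suc s) i j t

  iterate-step s = entry (⊕-cong (M-refl {M = idMat}) (entrywise (·-raises-agreement s (iterate-agree-below s))))
    where open MatrixAlgebra (truncation s)

  iterate-agree-below zero    i j t ()
  iterate-agree-below (suc s) i j t t<s = iterate-step s i j t (ℕ.s≤s⁻¹ t<s)

  iterate-stable : ∀ s d → iterate (suc s) ≈[ s ] iterate (suc (s ℕ.+ d))
  iterate-stable s zero    i j t t≤s = cong (λ e → iterate (suc e) i j t) (sym (ℕP.+-identityʳ s))
  iterate-stable s (suc d) i j t t≤s = trans (iterate-stable s d i j t t≤s)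
    (trans (iterate-step (s ℕ.+ d) i j t (ℕP.≤-trans t≤s (ℕP.m≤m+n s d)))
           (cong (λ e → iterate (suc e) i j t) (sym (ℕP.+-suc s d))))

  limit : Mat k k
  limit i j t = iterate (suc t) i j t

  limit-agrees : ∀ s → limit ≈[ s ] iterate (suc s)
  limit-agrees s i j t t≤s =
    subst (λ e → iterate (suc t) i j t ≡ iterate (suc e) i j t) (ℕP.m+[n∸m]≡n t≤s)
          (iterate-stable t (s ∸ t) i j t ℕP.≤-refl)

  -- Modulo x^(s+1): D·G ≈ D·Gₛ₊₁ = Gₛ₊₁ − E·Gₛ₊₁ ≈ Gₛ₊₂ − E·Gₛ₊₁ = I.
  right-inverse : (D · limit) ≋ idMat
  right-inverse i j s = entry D·G≈I i j s ℕP.≤-refl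
    where
    open MatrixAlgebra (truncation s)
    open MatReasoning
    X : Mat k k
    X = iterate (suc s)
    D⊕E≈I : (D ⊕ E) ≈M idMat
    D⊕E≈I = entrywise λ i j → ≗⇒≈ (λ t → add-sub (D i j t) (idMat i j t))
      where
      add-sub : ∀ (a b : ℤ) → a ℤ.+ (b ℤ.+ ℤ.- a) ≡ b
      add-sub = solve-∀
    D·G≈I : (D · limit) ≈M idMat
    D·G≈I = begin
      D · limit                      ≈⟨ ·-congʳ D (entrywise (limit-agrees s)) ⟩
      D · X                          ≈⟨ M-sym (⊕⊖-cancel (D · X) (E · X)) ⟩
      ((D · X) ⊕ (E · X)) ⊖ (E · X)  ≈⟨ ⊖-cong (M-sym (·-distribʳ X D E)) M-refl ⟩
      ((D ⊕ E) · X) ⊖ (E · X)        ≈⟨ ⊖-cong (M-trans (·-congˡ X D⊕E≈I) (·-identityˡ X)) M-refl ⟩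
      X ⊖ (E · X)                    ≈⟨ ⊖-cong (entrywise (iterate-step s)) M-refl ⟩
      (idMat ⊕ (E · X)) ⊖ (E · X)    ≈⟨ ⊕⊖-cancel idMat (E · X) ⟩
      idMat                          ∎

near-identity⇒right-inverse : ∀ {k} (D : Mat k k) → D ≈[ 0 ] idMat →
  Σ (Mat k k) (λ G → (D · G) ≋ idMat)
near-identity⇒right-inverse D D≈I = limit , right-inverse
  where open NeumannSeries D D≈I

-- Reducing to the finite rings ℤ/N (constant terms mod N) shows that R·M ≡ I mod x;
-- hence R·M has a right inverse Q, and R has the left inverse M and the right
-- inverse M·Q, so M is a two-sided inverse of R.
right⇒left-inverse : ∀ {n} (M R : Mat n n) → (M · R) ≋ idMat → (R · M) ≋ idMat
right⇒left-inverse {n} M R MR = entry (left-inverse-is-two-sided M R (M · Q) (exact⇒ MR) R·MQ≈I)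
  where
  open MatrixAlgebra exact

  RM≡I-mod : ∀ N i j → Congruence._≈_ (ConstantTermMod.congruence (suc N)) ((R · M) i j) (idMat i j)
  RM≡I-mod N = MatrixAlgebra.entry (FiniteQuotient.right⇒left R/N residue (λ {f g} → residue-sound {f} {g}) M R
                        (MatrixAlgebra.exact⇒ R/N MR))
    where
    open ConstantTermMod (suc N) using (residue; residue-sound) renaming (congruence to R/N)

  RM≈I : (R · M) ≈[ 0 ] idMat
  RM≈I i j .0 z≤n = ℤP.i-j≡0⇒i≡j _ _ (divisible-by-all⇒zero _ (λ N → RM≡I-mod N i j))

  Q : Mat n n
  Q = proj₁ (near-identity⇒right-inverse (R · M) RM≈I)

  R·MQ≈I : (R · (M · Q)) ≈M idMat
  R·MQ≈I = M-trans (M-sym (·-assoc R M Q)) (exact⇒ (proj₂ (near-identity⇒right-inverse (R · M) RM≈I)))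

-- Take R' = R·G where G inverts M'·R ≡ I mod x.
perturbed-inverse : ∀ {k} m (M R M' : Mat k k) → (M · R) ≋ idMat → (R · M) ≋ idMat →
  M' ≈[ m ] M → Σ (Mat k k) (λ R' → (M' · R') ≋ idMat × R' ≈[ m ] R)
perturbed-inverse {k} m M R M' MR RM M'≈M = R · G , M'R'≋I , entry R'≈R
  where
  M'R≈I : (M' · R) ≈[ 0 ] idMat
  M'R≈I = entry (M-trans (·-congˡ R (entrywise λ i j t t≤0 → M'≈M i j t (ℕP.≤-trans t≤0 z≤n))) (exact⇒ MR))
    where open MatrixAlgebra (truncation 0)

  G : Mat k k
  G = proj₁ (near-identity⇒right-inverse (M' · R) M'R≈I)

  M'R'≋I : (M' · (R · G)) ≋ idMat
  M'R'≋I = entry (M-trans (M-sym (·-assoc M' R G)) (exact⇒ (proj₂ (near-identity⇒right-inverse (M' · R) M'R≈I))))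
    where open MatrixAlgebra exact

  open MatrixAlgebra (truncation m)
  open MatReasoning
  R'≈R : (R · G) ≈M R
  R'≈R = begin
    R · G                  ≈⟨ M-sym (·-identityˡ (R · G)) ⟩
    idMat · (R · G)        ≈⟨ ·-congˡ (R · G) (exact⇒ (λ i j t → sym (RM i j t))) ⟩
    (R · M) · (R · G)      ≈⟨ ·-assoc R M (R · G) ⟩
    R · (M · (R · G))      ≈⟨ ·-congʳ R (·-congˡ (R · G) (M-sym (entrywise M'≈M))) ⟩
    R · (M' · (R · G))     ≈⟨ ·-congʳ R (exact⇒ M'R'≋I) ⟩
    R · idMat              ≈⟨ ·-identityʳ R ⟩
    R                      ∎

module Woodbury {n k} (A S Δ X : Mat n n) (U : Mat n k) (B : Mat k k) (V : Mat k n)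
  (S·A≋I : (S · A) ≋ idMat) (A+Δ·X≋I : ((A ⊕ Δ) · X) ≋ idMat) (Δ≋UBV : Δ ≋ ((U · B) · V)) where
  open MatrixAlgebra exact
  open MatReasoning

  P : Mat k n
  P = B · V

  capacitance : Mat k k
  capacitance = idMat ⊕ ((P · S) · U)

  W₀ : Mat k k
  W₀ = idMat ⊖ ((P · X) · U)

  -- S = S·(A + Δ)·X = X + S·Δ·X = X + SU·BVX.
  S-expansion : S ≈M (X ⊕ ((S · U) · (P · X)))
  S-expansion = begin
    S                               ≈⟨ M-sym (·-identityʳ S) ⟩
    S · idMat                       ≈⟨ ·-congʳ S (M-sym (exact⇒ A+Δ·X≋I)) ⟩
    S · ((A ⊕ Δ) · X)               ≈⟨ M-sym (·-assoc S (A ⊕ Δ) X) ⟩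
    (S · (A ⊕ Δ)) · X               ≈⟨ ·-congˡ X (·-distribˡ S A Δ) ⟩
    ((S · A) ⊕ (S · Δ)) · X         ≈⟨ ·-distribʳ X (S · A) (S · Δ) ⟩
    ((S · A) · X) ⊕ ((S · Δ) · X)   ≈⟨ ⊕-cong (M-trans (·-congˡ X (exact⇒ S·A≋I)) (·-identityˡ X)) SΔX≈ ⟩
    X ⊕ ((S · U) · (P · X))         ∎
    where
    SΔX≈ : ((S · Δ) · X) ≈M ((S · U) · (P · X))
    SΔX≈ = begin
      (S · Δ) · X                   ≈⟨ ·-congˡ X (·-congʳ S (M-trans (exact⇒ Δ≋UBV) (·-assoc U B V))) ⟩
      (S · (U · P)) · X             ≈⟨ ·-congˡ X (M-sym (·-assoc S U P)) ⟩
      ((S · U) · P) · X             ≈⟨ ·-assoc (S · U) P X ⟩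
      (S · U) · (P · X)             ∎

  -- BVS = (I + BVSU)·BVX: multiply the expansion of S by BV on the left.
  PS≈capacitance·PX : (P · S) ≈M (capacitance · (P · X))
  PS≈capacitance·PX = begin
    P · S                                          ≈⟨ ·-congʳ P S-expansion ⟩
    P · (X ⊕ ((S · U) · (P · X)))                  ≈⟨ ·-distribˡ P X ((S · U) · (P · X)) ⟩
    (P · X) ⊕ (P · ((S · U) · (P · X)))            ≈⟨ ⊕-cong (M-sym (·-identityˡ (P · X))) reassociate ⟩
    (idMat · (P · X)) ⊕ (((P · S) · U) · (P · X))  ≈⟨ M-sym (·-distribʳ (P · X) idMat ((P · S) · U)) ⟩
    capacitance · (P · X)                          ∎
    where
    reassociate : (P · ((S · U) · (P · X))) ≈M (((P · S) · U) · (P · X))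
    reassociate = M-trans (M-sym (·-assoc P (S · U) (P · X))) (·-congˡ (P · X) (M-sym (·-assoc P S U)))

  -- (I + BVSU)(I − BVXU) = I + BVSU − (I + BVSU)·BVX·U = I + BVSU − BVSU.
  W₀-right-inverse : (capacitance · W₀) ≋ idMat
  W₀-right-inverse = entry (begin
    capacitance · (idMat ⊖ T)                      ≈⟨ ·-⊖ˡ capacitance idMat T ⟩
    (capacitance · idMat) ⊖ (capacitance · T)      ≈⟨ ⊖-cong (·-identityʳ capacitance) capacitance·T≈ ⟩
    (idMat ⊕ ((P · S) · U)) ⊖ ((P · S) · U)        ≈⟨ ⊕⊖-cancel idMat ((P · S) · U) ⟩
    idMat                                          ∎)
    where
    T : Mat k k
    T = (P · X) · U
    capacitance·T≈ : (capacitance · T) ≈M ((P · S) · U)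
    capacitance·T≈ = M-trans (M-sym (·-assoc capacitance (P · X) U)) (·-congˡ U (M-sym PS≈capacitance·PX))

  -- X = S − SU·(BVX) and BVX = L·BVS.
  woodbury-formula : (L : Mat k k) → (L · capacitance) ≋ idMat → X ≋ (S ⊖ ((((S · U) · L) · P) · S))
  woodbury-formula L L·capacitance≋I = entry (begin
    X                                        ≈⟨ M-sym (⊕⊖-cancel X ((S · U) · (P · X))) ⟩
    (X ⊕ ((S · U) · (P · X))) ⊖ ((S · U) · (P · X))  ≈⟨ ⊖-cong (M-sym S-expansion) (·-congʳ (S · U) PX≈) ⟩
    S ⊖ ((S · U) · (L · (P · S)))            ≈⟨ ⊖-cong (M-refl {M = S}) reassociate ⟩
    S ⊖ ((((S · U) · L) · P) · S)            ∎)
    where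
    PX≈ : (P · X) ≈M (L · (P · S))
    PX≈ = begin
      P · X                                  ≈⟨ M-sym (·-identityˡ (P · X)) ⟩
      idMat · (P · X)                        ≈⟨ ·-congˡ (P · X) (M-sym (exact⇒ L·capacitance≋I)) ⟩
      (L · capacitance) · (P · X)            ≈⟨ ·-assoc L capacitance (P · X) ⟩
      L · (capacitance · (P · X))            ≈⟨ ·-congʳ L (M-sym PS≈capacitance·PX) ⟩
      L · (P · S)                            ∎
    reassociate : ((S · U) · (L · (P · S))) ≈M ((((S · U) · L) · P) · S)
    reassociate = M-trans (M-sym (·-assoc (S · U) L (P · S))) (M-sym (·-assoc ((S · U) · L) P S))

proposition14 : (n k m : ℕ) (A C ΔA X Ainv : Mat n n)
    (U : Mat n k) (B : Mat k k) (V : Mat k n) →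
    IsRightInverse A Ainv →
    C ≈[ m ] Ainv →
    IsRightInverse (A ⊕ ΔA) X →
    ΔA ≋ ((U · B) · V) →
    Σ (Mat k k) (λ W →
      IsRightInverse (idMat ⊕ (((B · V) · C) · U)) W ×
      (X ≈[ m ] (C ⊖ ((((C · U) · W) · (B · V)) · C))))
proposition14 n k m A C Δ X S U B V A·S≋I C≈S A+Δ·X≋I Δ≋UBV = W , M·W≋I , entry X≈
  where
  open Woodbury A S Δ X U B V (right⇒left-inverse A S A·S≋I) A+Δ·X≋I Δ≋UBV
  W₀·capacitance≋I : (W₀ · capacitance) ≋ idMat
  W₀·capacitance≋I = right⇒left-inverse capacitance W₀ W₀-right-inverse

  -- Replacing S by C changes the capacitance matrix only beyond order m, so its
  -- inverse changes only beyond order m.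
  open MatrixAlgebra (truncation m)
  S≈C : S ≈M C
  S≈C = M-sym (entrywise C≈S)
  M≈capacitance : (idMat ⊕ ((P · C) · U)) ≈M capacitance
  M≈capacitance = ⊕-cong (M-refl {M = idMat}) (·-congˡ U (·-congʳ P (entrywise C≈S)))
  perturbation : Σ (Mat k k) (λ R' →
    ((idMat ⊕ ((P · C) · U)) · R') ≋ idMat × R' ≈[ m ] W₀)
  perturbation = perturbed-inverse m capacitance W₀ _ W₀-right-inverse W₀·capacitance≋I (entry M≈capacitance)
  W : Mat k k
  W = proj₁ perturbation
  M·W≋I : ((idMat ⊕ ((P · C) · U)) · W) ≋ idMat
  M·W≋I = proj₁ (proj₂ perturbation)
  W₀≈W : W₀ ≈M W
  W₀≈W = M-sym (entrywise (proj₂ (proj₂ perturbation)))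

  X≈ : X ≈M (C ⊖ ((((C · U) · W) · P) · C))
  X≈ = M-trans (exact⇒ (woodbury-formula W₀ W₀·capacitance≋I))
         (⊖-cong S≈C (·-cong (·-congˡ P (·-cong (·-congˡ U S≈C) W₀≈W)) S≈C))
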